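{- For any integers $k \geq 2$, $\beta \geq 0$, and $0 \leq \alpha \leq k-1$, $$C_{k,(\alpha,\beta)}(t) = \begin{cases} C_k(t)^{\beta+1} & \text{ if } \alpha \leq \beta,\\ C_k(t)^{\beta+1} - 1 & \text{ if } \alpha > \beta. \end{cases}$$
   Context: For an integer $k\ge 2$ and integers $\alpha,\beta, n\ge 0$, let $C^k_{n,(\alpha,\beta)}$ be the number of integer lattice paths from $(0,\alpha)$ to $(kn+\beta-\alpha,\beta)$ using steps $U=(1,1)$ and $D=(1,1-k)$ that stay weakly above the line $y=0$ (such paths have exactly $n$ steps $D$; the empty path counts when $n=0$, $\alpha=\beta$; the count is $0$ when $kn+\beta-\alpha<0$). Let $C_{k,(\alpha,\beta)}(t)=\sum_{n\ge0} C^k_{n,(\alpha,\beta)}t^n$, and let $C_k(t)=\sum_{n\ge0} \frac{1}{kn+1}\binom{kn+1}{n} t^n$ be the generating function of the $k$-Catalan numbers. -}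

module Defs where

open import Data.Nat using (ℕ; zero; suc; _+_; _*_; _∸_; _≤_; _<_; _≤ᵇ_; _<ᵇ_)
open import Data.Nat.DivMod using (_/_)
open import Data.Nat.Combinatorics using (_C_)
open import Data.Bool using (Bool; true; false; if_then_else_; _∧_)
open import Data.List using (List; []; _∷_; map; _++_; upTo)
open import Data.Nat.ListAction using (sum)
open import Relation.Binary.PropositionalEquality using (_≡_)
open import Data.Nat using (_≡ᵇ_)

-- Steps: U = (1,1), D = (1, 1-k)
data Step : Set where
  U D : Step

allSeqs : ℕ → List (List Step)
allSeqs zero = [] ∷ []
allSeqs (suc L) = map (U ∷_) (allSeqs L) ++ map (D ∷_) (allSeqs L)

valid : ℕ → ℕ → ℕ → List Step → Bool
valid k h β [] = h ≡ᵇ β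
valid k h β (U ∷ p) = valid k (suc h) β p
valid k h β (D ∷ p) = ((k ∸ 1) ≤ᵇ h) ∧ valid k (h ∸ (k ∸ 1)) β p

countValid : ℕ → ℕ → ℕ → List (List Step) → ℕ
countValid k h β [] = 0
countValid k h β (p ∷ ps) = (if valid k h β p then 1 else 0) + countValid k h β ps

-- C^k_{n,(α,β)} : number of lattice paths from (0,α) to (kn+β-α, β)
-- with steps U, D staying weakly above y = 0 (zero if kn+β-α < 0).
pathCount : (k n α β : ℕ) → ℕ
pathCount k n α β =
  if (k * n + β) <ᵇ α then 0
  else countValid k α β (allSeqs (k * n + β ∸ α))

Series : Set
Series = ℕ → ℕ

oneS : Series
oneS zero = 1
oneS (suc _) = 0

_+S_ : Series → Series → Series
(f +S g) n = f n + g n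

_*S_ : Series → Series → Series
(f *S g) n = sum (map (λ i → f i * g (n ∸ i)) (upTo (suc n)))

_^S_ : Series → ℕ → Series
f ^S zero = oneS
f ^S suc m = f *S (f ^S m)

pathGF : (k α β : ℕ) → Series
pathGF k α β n = pathCount k n α β

catalanGF : ℕ → Series
catalanGF k n = (suc (k * n) C n) / suc (k * n)

_≈S_ : Series → Series → Set
f ≈S g = ∀ n → f n ≡ g n

module Submission where

-- Since C_k = 1 + t C_k^k, the coefficients R(r, n) of C_k^r satisfy
-- R(r+1, n+1) = R(r, n+1) + R(r+k, n).  Splitting a path by its last step (an up step
-- from height β−1 or a down step from height β+k−1) gives the path counts the same
-- recursion in r = β+1, and α ≤ k−1 makes the base cases agree for n ≥ 1.  For n = 0 the
-- only candidate is the straight climb, present iff α ≤ β.  That C_k itself is R(1, ·)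
-- follows from the closed form R(r, n) (kn+r) = r·binom(kn+r, n), proved by induction
-- from Pascal's rule and absorption.

open import Data.Bool using (true; false; if_then_else_; _∧_)
open import Data.Bool.Properties using (if-cong-then; T-≡)
open import Data.List using (_∷_; []; map; applyUpTo; _++_)
open import Data.Nat using (ℕ; zero; suc; _+_; _*_; _∸_; _≤_; _<_; _≤ᵇ_; _<ᵇ_; _≡ᵇ_; s≤s; s≤s⁻¹; z<s; NonZero)
open import Data.Nat.Combinatorics using (_C_; nCk+nC[k+1]≡[n+1]C[k+1]; k>n⇒nCk≡0; nC1≡n)
open import Data.Nat.DivMod using (_/_; m*n/n≡m)
open import Data.Nat.ListAction using (sum)
open import Data.Nat.Properties
open import Algebra.Properties.CommutativeSemigroup +-commutativeSemigroup using (interchange)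
open import Data.Nat.Tactic.RingSolver using (solve-∀)
open import Data.Product using (_×_; _,_)
open import Function using (_∘_)
open import Function.Bundles using (Equivalence)
open import Relation.Binary.PropositionalEquality
open ≡-Reasoning

open import Defs

[1+k]*[1+n]C[1+k]≡[1+n]*nCk : ∀ n k → suc k * (suc n C suc k) ≡ suc n * (n C k)
[1+k]*[1+n]C[1+k]≡[1+n]*nCk zero    zero    = refl
[1+k]*[1+n]C[1+k]≡[1+n]*nCk zero    (suc k) = begin
  suc (suc k) * (1 C suc (suc k)) ≡⟨ cong (suc (suc k) *_) (k>n⇒nCk≡0 {1} {suc (suc k)} (s≤s z<s)) ⟩
  suc (suc k) * 0                 ≡⟨ *-zeroʳ (suc (suc k)) ⟩
  0                               ≡⟨ cong (1 *_) (k>n⇒nCk≡0 {0} {suc k} z<s) ⟨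
  1 * (0 C suc k)                 ∎
[1+k]*[1+n]C[1+k]≡[1+n]*nCk (suc n) zero = begin
  1 * (suc (suc n) C 1) ≡⟨ *-identityˡ _ ⟩
  suc (suc n) C 1       ≡⟨ nC1≡n (suc (suc n)) ⟩
  suc (suc n)           ≡⟨ *-identityʳ (suc (suc n)) ⟨
  suc (suc n) * 1       ∎
[1+k]*[1+n]C[1+k]≡[1+n]*nCk (suc n) (suc k) = begin
  (2 + k) * (suc (suc n) C (2 + k))       ≡⟨ cong ((2 + k) *_) (nCk+nC[k+1]≡[n+1]C[k+1] (suc n) (suc k)) ⟨
  (2 + k) * (x + y)                        ≡⟨ expand k x y ⟩
  x + ((1 + k) * x + (2 + k) * y)          ≡⟨ cong (x +_) (cong₂ _+_ ([1+k]*[1+n]C[1+k]≡[1+n]*nCk n k)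
                                                                   ([1+k]*[1+n]C[1+k]≡[1+n]*nCk n (suc k))) ⟩
  x + ((1 + n) * (n C k) + (1 + n) * (n C suc k)) ≡⟨ cong (x +_) (*-distribˡ-+ (1 + n) (n C k) (n C suc k)) ⟨
  x + (1 + n) * (n C k + n C suc k)        ≡⟨ cong (λ z → x + (1 + n) * z) (nCk+nC[k+1]≡[n+1]C[k+1] n k) ⟩
  x + (1 + n) * x                          ∎
  where
  x = suc n C suc k
  y = suc n C suc (suc k)
  expand : ∀ k x y → (2 + k) * (x + y) ≡ x + ((1 + k) * x + (2 + k) * y)
  expand = solve-∀

-- raney k r n is the coefficient of tⁿ in C_k(t)^r.
raney : ℕ → ℕ → ℕ → ℕ
raney k r       zero    = 1
raney k zero    (suc n) = 0
raney k (suc r) (suc n) = raney k r (suc n) + raney k (k + r) n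

raney-closedForm-step : ∀ k .{{_ : NonZero k}} n s F₁ F₂ b b' →
  F₁ * (k * suc n + s) ≡ s * b' →
  F₂ * (k * suc n + s) ≡ (k + s) * b →
  suc n * (b + b') ≡ suc (k * suc n + s) * b →
  (F₁ + F₂) * suc (k * suc n + s) ≡ suc s * (b + b')
-- F₁ and F₂ are only known times M = k (n+1) + s, so the identity is checked after
-- multiplying by M (n+1); this cancellation is where k ≠ 0 is needed.
raney-closedForm-step k@(suc _) n s F₁ F₂ b b' eq₁ eq₂ absorb =
  *-cancelʳ-≡ _ _ (M * suc n) (begin
    (F₁ + F₂) * suc M * (M * suc n)             ≡⟨ regroup₁ F₁ F₂ M n ⟩
    (F₁ * M + F₂ * M) * suc n * suc M           ≡⟨ cong (λ z → z * suc n * suc M) (cong₂ _+_ eq₁ eq₂) ⟩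
    (s * b' + (k + s) * b) * suc n * suc M      ≡⟨ cong (_* suc M) key ⟩
    suc s * M * b * suc M                       ≡⟨ regroup₂ s M b ⟩
    suc s * M * (suc M * b)                     ≡⟨ cong (suc s * M *_) absorb ⟨
    suc s * M * (suc n * (b + b'))              ≡⟨ regroup₃ s M n (b + b') ⟩
    suc s * (b + b') * (M * suc n)              ∎)
  where
  M = k * suc n + s
  key : (s * b' + (k + s) * b) * suc n ≡ suc s * M * b
  key = +-cancelʳ-≡ (s * suc n * b) _ _ (begin
    (s * b' + (k + s) * b) * suc n + s * suc n * b ≡⟨ regroup₄ s b b' k n ⟩
    s * (suc n * (b + b')) + (k + s) * suc n * b  ≡⟨ cong (λ z → s * z + (k + s) * suc n * b) absorb ⟩
    s * (suc M * b) + (k + s) * suc n * b          ≡⟨ regroup₅ s b k n ⟩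
    suc s * M * b + s * suc n * b                  ∎)
    where
    regroup₄ : ∀ s b b' k n →
      (s * b' + (k + s) * b) * suc n + s * suc n * b ≡ s * (suc n * (b + b')) + (k + s) * suc n * b
    regroup₄ = solve-∀
    regroup₅ : ∀ s b k n →
      s * (suc (k * suc n + s) * b) + (k + s) * suc n * b ≡ suc s * (k * suc n + s) * b + s * suc n * b
    regroup₅ = solve-∀
  regroup₁ : ∀ F₁ F₂ M n → (F₁ + F₂) * suc M * (M * suc n) ≡ (F₁ * M + F₂ * M) * suc n * suc M
  regroup₁ = solve-∀
  regroup₂ : ∀ s M b → suc s * M * b * suc M ≡ suc s * M * (suc M * b)
  regroup₂ = solve-∀
  regroup₃ : ∀ s M n x → suc s * M * (suc n * x) ≡ suc s * x * (M * suc n)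
  regroup₃ = solve-∀

raney-closedForm : ∀ k .{{_ : NonZero k}} r n → raney k r n * (k * n + r) ≡ r * ((k * n + r) C n)
raney-closedForm k r zero = begin
  1 * (k * 0 + r) ≡⟨ *-identityˡ _ ⟩
  k * 0 + r       ≡⟨ cong (_+ r) (*-zeroʳ k) ⟩
  r               ≡⟨ *-identityʳ r ⟨
  r * 1           ∎
raney-closedForm k zero (suc n) = refl
raney-closedForm k (suc s) (suc n) = begin
  (F₁ + F₂) * (k * suc n + suc s)     ≡⟨ cong ((F₁ + F₂) *_) (+-suc (k * suc n) s) ⟩
  (F₁ + F₂) * suc M
    ≡⟨ raney-closedForm-step k n s F₁ F₂ (M C n) (M C suc n) (raney-closedForm k s (suc n)) eq₂ absorb ⟩
  suc s * (M C n + M C suc n)         ≡⟨ cong (suc s *_) (nCk+nC[k+1]≡[n+1]C[k+1] M n) ⟩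
  suc s * (suc M C suc n)             ≡⟨ cong (λ m → suc s * (m C suc n)) (+-suc (k * suc n) s) ⟨
  suc s * ((k * suc n + suc s) C suc n) ∎
  where
  M  = k * suc n + s
  F₁ = raney k s (suc n)
  F₂ = raney k (k + s) n
  eq₂ : F₂ * M ≡ (k + s) * (M C n)
  eq₂ = subst (λ m → F₂ * m ≡ (k + s) * (m C n)) (shiftedLength k n s) (raney-closedForm k (k + s) n)
    where
    shiftedLength : ∀ k n s → k * n + (k + s) ≡ k * suc n + s
    shiftedLength = solve-∀
  absorb : suc n * (M C n + M C suc n) ≡ suc M * (M C n)
  absorb = trans (cong (suc n *_) (nCk+nC[k+1]≡[n+1]C[k+1] M n)) ([1+k]*[1+n]C[1+k]≡[1+n]*nCk M n)

catalanGF≈raney1 : ∀ k .{{_ : NonZero k}} → catalanGF k ≈S raney k 1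
catalanGF≈raney1 k n = begin
  (suc (k * n) C n) / suc (k * n)             ≡⟨ cong (_/ suc (k * n)) numerator ⟨
  (raney k 1 n * suc (k * n)) / suc (k * n)   ≡⟨ m*n/n≡m (raney k 1 n) (suc (k * n)) ⟩
  raney k 1 n                                 ∎
  where
  numerator : raney k 1 n * suc (k * n) ≡ suc (k * n) C n
  numerator = subst (λ m → raney k 1 n * m ≡ m C n) (+-comm (k * n) 1)
                    (trans (raney-closedForm k 1 n) (*-identityˡ _))

∑< : ℕ → (ℕ → ℕ) → ℕ
∑< zero    f = 0
∑< (suc n) f = f 0 + ∑< n (f ∘ suc)

sum-map-applyUpTo : ∀ (g f : ℕ → ℕ) n → sum (map g (applyUpTo f n)) ≡ ∑< n (g ∘ f)
sum-map-applyUpTo g f zero    = refl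
sum-map-applyUpTo g f (suc n) = cong (g (f 0) +_) (sum-map-applyUpTo g (f ∘ suc) n)

∑<-cong : ∀ n {f g} → (∀ i → f i ≡ g i) → ∑< n f ≡ ∑< n g
∑<-cong zero    f≗g = refl
∑<-cong (suc n) f≗g = cong₂ _+_ (f≗g 0) (∑<-cong n (λ i → f≗g (suc i)))

∑<-distrib-+ : ∀ n f g → ∑< n (λ i → f i + g i) ≡ ∑< n f + ∑< n g
∑<-distrib-+ zero    f g = refl
∑<-distrib-+ (suc n) f g = begin
  f 0 + g 0 + ∑< n (λ i → f (suc i) + g (suc i))
    ≡⟨ cong (f 0 + g 0 +_) (∑<-distrib-+ n (f ∘ suc) (g ∘ suc)) ⟩
  f 0 + g 0 + (∑< n (f ∘ suc) + ∑< n (g ∘ suc))  ≡⟨ interchange (f 0) (g 0) _ _ ⟩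
  f 0 + ∑< n (f ∘ suc) + (g 0 + ∑< n (g ∘ suc))  ∎

∑<-zero : ∀ n → ∑< n (λ _ → 0) ≡ 0
∑<-zero zero    = refl
∑<-zero (suc n) = ∑<-zero n

*S-as-∑< : ∀ f g n → (f *S g) n ≡ ∑< (suc n) (λ i → f i * g (n ∸ i))
*S-as-∑< f g n = sum-map-applyUpTo (λ i → f i * g (n ∸ i)) (λ i → i) (suc n)

*S-cong : ∀ {f f' g g'} → f ≈S f' → g ≈S g' → (f *S g) ≈S (f' *S g')
*S-cong {f} {f'} {g} {g'} f≈f' g≈g' n = begin
  (f *S g) n                              ≡⟨ *S-as-∑< f g n ⟩
  ∑< (suc n) (λ i → f i * g (n ∸ i))
    ≡⟨ ∑<-cong (suc n) (λ i → cong₂ _*_ (f≈f' i) (g≈g' (n ∸ i))) ⟩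
  ∑< (suc n) (λ i → f' i * g' (n ∸ i))    ≡⟨ *S-as-∑< f' g' n ⟨
  (f' *S g') n                            ∎

*S-identityˡ : ∀ g → (oneS *S g) ≈S g
*S-identityˡ g n = begin
  (oneS *S g) n         ≡⟨ *S-as-∑< oneS g n ⟩
  g n + 0 + ∑< n (λ _ → 0) ≡⟨ cong (g n + 0 +_) (∑<-zero n) ⟩
  g n + 0 + 0           ≡⟨ cong (_+ 0) (+-identityʳ (g n)) ⟩
  g n + 0               ≡⟨ +-identityʳ (g n) ⟩
  g n                   ∎

*S-distribʳ-+S : ∀ f g h → ((f +S g) *S h) ≈S ((f *S h) +S (g *S h))
*S-distribʳ-+S f g h n = begin
  ((f +S g) *S h) n                                   ≡⟨ *S-as-∑< (f +S g) h n ⟩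
  ∑< (suc n) (λ i → (f i + g i) * h (n ∸ i))
    ≡⟨ ∑<-cong (suc n) (λ i → *-distribʳ-+ (h (n ∸ i)) (f i) (g i)) ⟩
  ∑< (suc n) (λ i → f i * h (n ∸ i) + g i * h (n ∸ i))
    ≡⟨ ∑<-distrib-+ (suc n) (λ i → f i * h (n ∸ i)) (λ i → g i * h (n ∸ i)) ⟩
  ∑< (suc n) (λ i → f i * h (n ∸ i)) + ∑< (suc n) (λ i → g i * h (n ∸ i))
                                                      ≡⟨ cong₂ _+_ (*S-as-∑< f h n) (*S-as-∑< g h n) ⟨
  (f *S h) n + (g *S h) n                             ∎

shift : Series → Series
shift f zero    = 0
shift f (suc n) = f n

*S-shiftˡ : ∀ f g → (shift f *S g) ≈S shift (f *S g)
*S-shiftˡ f g zero    = refl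
*S-shiftˡ f g (suc n) = trans (*S-as-∑< (shift f) g (suc n)) (sym (*S-as-∑< f g n))

raney-zero : ∀ k → raney k 0 ≈S oneS
raney-zero k zero    = refl
raney-zero k (suc n) = refl

raney-suc : ∀ k r → raney k (suc r) ≈S (raney k r +S shift (raney k (k + r)))
raney-suc k r zero    = refl
raney-suc k r (suc n) = refl

raney-+ : ∀ k a b → raney k (a + b) ≈S (raney k a *S raney k b)
raney-+ k a       b zero    = refl
raney-+ k zero    b (suc n) =
  sym (trans (*S-cong {g = raney k b} (raney-zero k) (λ _ → refl) (suc n)) (*S-identityˡ (raney k b) (suc n)))
raney-+ k (suc a) b (suc n) = begin
  raney k (a + b) (suc n) + raney k (k + (a + b)) n
    ≡⟨ cong₂ _+_ (raney-+ k a b (suc n))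
                 (trans (cong (λ r → raney k r n) (sym (+-assoc k a b))) (raney-+ k (k + a) b n)) ⟩
  (raney k a *S raney k b) (suc n) + (raney k (k + a) *S raney k b) n
    ≡⟨ cong ((raney k a *S raney k b) (suc n) +_) (*S-shiftˡ (raney k (k + a)) (raney k b) (suc n)) ⟨
  (raney k a *S raney k b) (suc n) + (shift (raney k (k + a)) *S raney k b) (suc n)
    ≡⟨ *S-distribʳ-+S (raney k a) (shift (raney k (k + a))) (raney k b) (suc n) ⟨
  ((raney k a +S shift (raney k (k + a))) *S raney k b) (suc n)
    ≡⟨ *S-cong {g = raney k b} (raney-suc k a) (λ _ → refl) (suc n) ⟨
  (raney k (suc a) *S raney k b) (suc n) ∎

catalanGF^≈raney : ∀ k .{{_ : NonZero k}} r → (catalanGF k ^S r) ≈S raney k r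
catalanGF^≈raney k zero    n = sym (raney-zero k n)
catalanGF^≈raney k (suc r) n = trans (*S-cong (catalanGF≈raney1 k) (catalanGF^≈raney k r) n) (sym (raney-+ k 1 r n))

countValid-++ : ∀ k h β ps qs → countValid k h β (ps ++ qs) ≡ countValid k h β ps + countValid k h β qs
countValid-++ k h β []       qs = refl
countValid-++ k h β (p ∷ ps) qs = trans (cong (_ +_) (countValid-++ k h β ps qs))
                                        (sym (+-assoc (if valid k h β p then 1 else 0) _ _))

countValid-U∷ : ∀ k h β ps → countValid k h β (map (U ∷_) ps) ≡ countValid k (suc h) β ps
countValid-U∷ k h β []       = refl
countValid-U∷ k h β (p ∷ ps) = cong (_ +_) (countValid-U∷ k h β ps)

countValid-D∷ : ∀ k h β ps → countValid k h β (map (D ∷_) ps) ≡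
  (if (k ∸ 1) ≤ᵇ h then countValid k (h ∸ (k ∸ 1)) β ps else 0)
countValid-D∷ k h β [] with (k ∸ 1) ≤ᵇ h
... | true  = refl
... | false = refl
countValid-D∷ k h β (p ∷ ps) with (k ∸ 1) ≤ᵇ h | countValid-D∷ k h β ps
... | true  | ih = cong (_ +_) ih
... | false | ih = ih

#paths : ℕ → ℕ → ℕ → ℕ → ℕ
#paths k h β L = countValid k h β (allSeqs L)

#paths-firstStep : ∀ k h β L → #paths k h β (suc L) ≡
  #paths k (suc h) β L + (if (k ∸ 1) ≤ᵇ h then #paths k (h ∸ (k ∸ 1)) β L else 0)
#paths-firstStep k h β L = begin
  countValid k h β (map (U ∷_) (allSeqs L) ++ map (D ∷_) (allSeqs L))
    ≡⟨ countValid-++ k h β (map (U ∷_) (allSeqs L)) (map (D ∷_) (allSeqs L)) ⟩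
  countValid k h β (map (U ∷_) (allSeqs L)) + countValid k h β (map (D ∷_) (allSeqs L))
    ≡⟨ cong₂ _+_ (countValid-U∷ k h β (allSeqs L)) (countValid-D∷ k h β (allSeqs L)) ⟩
  #paths k (suc h) β L + (if (k ∸ 1) ≤ᵇ h then #paths k (h ∸ (k ∸ 1)) β L else 0) ∎

[d≤ᵇh]∧[h∸d≡ᵇβ]≡[h≡ᵇd+β] : ∀ d h β → ((d ≤ᵇ h) ∧ ((h ∸ d) ≡ᵇ β)) ≡ (h ≡ᵇ d + β)
[d≤ᵇh]∧[h∸d≡ᵇβ]≡[h≡ᵇd+β] zero    h       β = refl
[d≤ᵇh]∧[h∸d≡ᵇβ]≡[h≡ᵇd+β] (suc d) zero    β = refl
[d≤ᵇh]∧[h∸d≡ᵇβ]≡[h≡ᵇd+β] (suc d) (suc h) β =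
  trans (cong (_∧ ((h ∸ d) ≡ᵇ β)) (<ᵇ-suc d)) ([d≤ᵇh]∧[h∸d≡ᵇβ]≡[h≡ᵇd+β] d h β)
  where
  <ᵇ-suc : ∀ d → (d <ᵇ suc h) ≡ (d ≤ᵇ h)
  <ᵇ-suc zero    = refl
  <ᵇ-suc (suc d) = refl

if-+ : ∀ c x y → (if c then x + y else 0) ≡ (if c then x else 0) + (if c then y else 0)
if-+ true  x y = refl
if-+ false x y = refl

#paths-lastStep-zero : ∀ d h L → #paths (suc d) h 0 (suc L) ≡ #paths (suc d) h (d + 0) L
#paths-lastStep-zero d h zero = cong (λ b → (if b then 1 else 0) + 0) ([d≤ᵇh]∧[h∸d≡ᵇβ]≡[h≡ᵇd+β] d h 0)
#paths-lastStep-zero d h (suc L) = begin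
  #paths (suc d) h 0 (2 + L)                                            ≡⟨ #paths-firstStep (suc d) h 0 (suc L) ⟩
  #paths (suc d) (suc h) 0 (suc L) + (if c then #paths (suc d) (h ∸ d) 0 (suc L) else 0)
    ≡⟨ cong₂ _+_ (#paths-lastStep-zero d (suc h) L) (if-cong-then c (#paths-lastStep-zero d (h ∸ d) L)) ⟩
  #paths (suc d) (suc h) (d + 0) L + (if c then #paths (suc d) (h ∸ d) (d + 0) L else 0)
                                                                        ≡⟨ #paths-firstStep (suc d) h (d + 0) L ⟨
  #paths (suc d) h (d + 0) (suc L)                                      ∎
  where
  c = d ≤ᵇ h

#paths-lastStep-suc : ∀ d h β L →
  #paths (suc d) h (suc β) (suc L) ≡ #paths (suc d) h β L + #paths (suc d) h (d + suc β) L
#paths-lastStep-suc d h β zero =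
  cong₂ _+_ (sym (+-identityʳ (if h ≡ᵇ β then 1 else 0)))
            (cong (λ b → (if b then 1 else 0) + 0) ([d≤ᵇh]∧[h∸d≡ᵇβ]≡[h≡ᵇd+β] d h (suc β)))
#paths-lastStep-suc d h β (suc L) = begin
  #paths k h (suc β) (2 + L)                                             ≡⟨ #paths-firstStep k h (suc β) (suc L) ⟩
  #paths k (suc h) (suc β) (suc L) + (if c then #paths k (h ∸ d) (suc β) (suc L) else 0)
    ≡⟨ cong₂ _+_ (#paths-lastStep-suc d (suc h) β L) (if-cong-then c (#paths-lastStep-suc d (h ∸ d) β L)) ⟩
  (a + a') + (if c then b + b' else 0)                                   ≡⟨ cong ((a + a') +_) (if-+ c b b') ⟩
  (a + a') + ((if c then b else 0) + (if c then b' else 0))              ≡⟨ interchange a a' _ _ ⟩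
  (a + (if c then b else 0)) + (a' + (if c then b' else 0))
    ≡⟨ cong₂ _+_ (#paths-firstStep k h β L) (#paths-firstStep k h (d + suc β) L) ⟨
  #paths k h β (suc L) + #paths k h (d + suc β) (suc L)                  ∎
  where
  k  = suc d
  c  = d ≤ᵇ h
  a  = #paths k (suc h) β L
  a' = #paths k (suc h) (d + suc β) L
  b  = #paths k (h ∸ d) β L
  b' = #paths k (h ∸ d) (d + suc β) L

<⇒[≡ᵇ]≡false : ∀ {m n} → m < n → (m ≡ᵇ n) ≡ false
<⇒[≡ᵇ]≡false {zero}  {suc n} _         = refl
<⇒[≡ᵇ]≡false {suc m} {suc n} (s≤s m<n) = <⇒[≡ᵇ]≡false m<n

#paths-tooHigh : ∀ d h β L → h + L < β → #paths (suc d) h β L ≡ 0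
#paths-tooHigh d h β       zero    h+0<β =
  cong (λ b → (if b then 1 else 0) + 0) (<⇒[≡ᵇ]≡false (subst (_< β) (+-identityʳ h) h+0<β))
#paths-tooHigh d h (suc β) (suc L) h+1+L<1+β = begin
  #paths (suc d) h (suc β) (suc L)                          ≡⟨ #paths-lastStep-suc d h β L ⟩
  #paths (suc d) h β L + #paths (suc d) h (d + suc β) L     ≡⟨ cong₂ _+_ (#paths-tooHigh d h β L h+L<β)
                                                                       (#paths-tooHigh d h (d + suc β) L h+L<d+1+β) ⟩
  0                                                         ∎
  where
  h+L<β : h + L < β
  h+L<β = s≤s⁻¹ (subst (_< suc β) (+-suc h L) h+1+L<1+β)
  h+L<d+1+β : h + L < d + suc β
  h+L<d+1+β = ≤-trans (m≤n⇒m≤1+n h+L<β) (m≤n+m (suc β) d)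

#paths-allUp : ∀ d h L → #paths (suc d) h (h + L) L ≡ 1
#paths-allUp d h zero    = cong (λ b → (if b then 1 else 0) + 0)
                                (Equivalence.to T-≡ (≡⇒≡ᵇ h (h + 0) (sym (+-identityʳ h))))
#paths-allUp d h (suc L) = begin
  #paths (suc d) h (h + suc L) (suc L)
    ≡⟨ cong (λ γ → #paths (suc d) h γ (suc L)) (+-suc h L) ⟩
  #paths (suc d) h (suc (h + L)) (suc L)
    ≡⟨ #paths-lastStep-suc d h (h + L) L ⟩
  #paths (suc d) h (h + L) L + #paths (suc d) h (d + suc (h + L)) L
    ≡⟨ cong₂ _+_ (#paths-allUp d h L) (#paths-tooHigh d h _ L (m≤n+m (suc (h + L)) d)) ⟩
  1 ∎

m+n<ᵇm≡false : ∀ m n → (m + n <ᵇ m) ≡ false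
m+n<ᵇm≡false zero    n = refl
m+n<ᵇm≡false (suc m) n = m+n<ᵇm≡false m n

pathCount≡#paths : ∀ k n α β L → k * n + β ≡ α + L → pathCount k n α β ≡ #paths k α β L
pathCount≡#paths k n α β L eq = begin
  (if k * n + β <ᵇ α then 0 else #paths k α β (k * n + β ∸ α))
    ≡⟨ cong (λ x → if x <ᵇ α then 0 else #paths k α β (x ∸ α)) eq ⟩
  (if α + L <ᵇ α then 0 else #paths k α β (α + L ∸ α))
    ≡⟨ cong (if_then 0 else #paths k α β (α + L ∸ α)) (m+n<ᵇm≡false α L) ⟩
  #paths k α β (α + L ∸ α)                                      ≡⟨ cong (#paths k α β) (m+n∸m≡n α L) ⟩
  #paths k α β L                                                ∎

pathCount-below : ∀ k n α β → k * n + β < α → pathCount k n α β ≡ 0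
pathCount-below k n α β lt =
  cong (if_then 0 else #paths k α β (k * n + β ∸ α)) (Equivalence.to T-≡ (<⇒<ᵇ lt))

module _ (α e : ℕ) where
  private
    d k : ℕ
    d = α + e
    k = suc d

  -- A path from height α with m steps D ending at height γ has length k m + γ − α;
  -- the lengths below are the cases (m, γ) = (n + 1, β) and (n, d + β).
  mutual
    #paths≡raney : ∀ n β → #paths k α β (k * n + e + suc β) ≡ raney k (suc β) (suc n)
    #paths≡raney n zero = begin
      #paths k α 0 (k * n + e + 1)        ≡⟨ cong (#paths k α 0) (+-suc (k * n + e) 0) ⟩
      #paths k α 0 (suc (k * n + e + 0))  ≡⟨ #paths-lastStep-zero d α (k * n + e + 0) ⟩
      #paths k α (d + 0) (k * n + e + 0)  ≡⟨ #paths≡raney-high n 0 ⟩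
      raney k (suc (d + 0)) n             ∎
    #paths≡raney n (suc β) = begin
      #paths k α (suc β) (k * n + e + suc (suc β))   ≡⟨ cong (#paths k α (suc β)) (+-suc (k * n + e) (suc β)) ⟩
      #paths k α (suc β) (suc (k * n + e + suc β))   ≡⟨ #paths-lastStep-suc d α β (k * n + e + suc β) ⟩
      #paths k α β (k * n + e + suc β) + #paths k α (d + suc β) (k * n + e + suc β)
        ≡⟨ cong₂ _+_ (#paths≡raney n β) (#paths≡raney-high n (suc β)) ⟩
      raney k (suc (suc β)) (suc n)                  ∎

    #paths≡raney-high : ∀ n β → #paths k α (d + β) (k * n + e + β) ≡ raney k (suc (d + β)) n
    #paths≡raney-high zero    β =
      trans (cong₂ (#paths k α) (+-assoc α e β) (lengthOfAllUp α e β)) (#paths-allUp d α (e + β))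
      where
      lengthOfAllUp : ∀ α e β → suc (α + e) * 0 + e + β ≡ e + β
      lengthOfAllUp = solve-∀
    #paths≡raney-high (suc n) β =
      trans (cong (#paths k α (d + β)) (oneDStepMore α e n β)) (#paths≡raney n (d + β))
      where
      oneDStepMore : ∀ α e n β → suc (α + e) * suc n + e + β ≡ suc (α + e) * n + e + suc (α + e + β)
      oneDStepMore = solve-∀

  pathGF-suc : ∀ β n → pathGF k α β (suc n) ≡ raney k (suc β) (suc n)
  pathGF-suc β n = trans (pathCount≡#paths k (suc n) α β _ (lengthOfPaths α e n β)) (#paths≡raney n β)
    where
    lengthOfPaths : ∀ α e n β → suc (α + e) * suc n + β ≡ α + (suc (α + e) * n + e + suc β)
    lengthOfPaths = solve-∀

pathGF-zero-≤ : ∀ d α β → α ≤ β → pathGF (suc d) α β 0 ≡ 1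
pathGF-zero-≤ d α β α≤β with m≤n⇒∃[o]m+o≡n α≤β
... | L , refl =
  trans (pathCount≡#paths (suc d) 0 α (α + L) L (cong (_+ (α + L)) (*-zeroʳ d))) (#paths-allUp d α L)

pathGF-zero-> : ∀ k α β → β < α → pathGF k α β 0 ≡ 0
pathGF-zero-> k α β β<α = pathCount-below k 0 α β (subst (_< α) (sym (cong (_+ β) (*-zeroʳ k))) β<α)

pathGF≈catalanGF^ : ∀ k α β → α < k →
  (α ≤ β → pathGF k α β ≈S (catalanGF k ^S (β + 1))) ×
  (β < α → (pathGF k α β +S oneS) ≈S (catalanGF k ^S (β + 1)))
pathGF≈catalanGF^ k α β α<k with m≤n⇒∃[o]m+o≡n α<k
... | e , refl = case-α≤β , case-β<α
  where
  coefficient : ∀ n → (catalanGF k ^S (β + 1)) n ≡ raney k (suc β) n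
  coefficient n = trans (catalanGF^≈raney k (β + 1) n) (cong (λ r → raney k r n) (+-comm β 1))
  case-α≤β : α ≤ β → pathGF k α β ≈S (catalanGF k ^S (β + 1))
  case-α≤β α≤β zero    = trans (pathGF-zero-≤ (α + e) α β α≤β) (sym (coefficient 0))
  case-α≤β α≤β (suc n) = trans (pathGF-suc α e β n) (sym (coefficient (suc n)))
  case-β<α : β < α → (pathGF k α β +S oneS) ≈S (catalanGF k ^S (β + 1))
  case-β<α β<α zero    = trans (cong (_+ 1) (pathGF-zero-> k α β β<α)) (sym (coefficient 0))
  case-β<α β<α (suc n) = trans (+-identityʳ _) (trans (pathGF-suc α e β n) (sym (coefficient (suc n))))

corollary2p5 : (k α β : ℕ) → 2 ≤ k → α ≤ k ∸ 1 →
    (α ≤ β → pathGF k α β ≈S (catalanGF k ^S (β + 1))) ×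
    (β < α → (pathGF k α β +S oneS) ≈S (catalanGF k ^S (β + 1)))
-- The hypothesis 2 ≤ k only excludes k = 0; the identity holds for k = 1 as well.
corollary2p5 zero    α β () _
corollary2p5 (suc k) α β _  α≤k = pathGF≈catalanGF^ (suc k) α β (s≤s α≤k)
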